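{- Let $F$ be a tract, $E$ a finite set, $\mathcal W\subseteq F^E$ an $F$-vector set and $B$ a support basis of $\mathcal W$. Then the reduced row-echelon form for $\mathcal W$ with respect to $B$ is unique.
   Context: A tract is a multiplicative group $G$ with a subset $N_G\subseteq\mathbb N[G]$ such that $0\in N_G$, $1\notin N_G$, there is a unique $\eta\in G$ with $1+\eta\in N_G$, and $N_G$ is closed under multiplication by $G$. Write $F=G\cup\{0\}$, $-g:=\eta g$, and for $a_1,\dots,a_k\in F$, $\boxplus_j a_j:=\{b\in F: -b+\sum_j a_j\in N_G\}$ (zero terms dropped; empty hypersum $=\{0\}$). For vectors in $F^E$, $\boxplus$ is taken componentwise: $\boxplus_jX_j=\{Z: Z(e)\in\boxplus_jX_j(e)\ \forall e\}$; $F$ acts componentwise; $\underline X=\{e:X(e)\neq0\}$. $X$ is a linear combination of $Y_1,\dots,Y_k$ if $X\in\boxplus_j\alpha_jY_j$ for some $\alpha_j\in F$. A support basis of $\mathcal W$ is an inclusion-minimal $B\subseteq E$ meeting the support of every nonzero element of $\mathcal W$. A nearly reduced row-echelon form w.r.t. $B$ is a subset $\{S_j:j\in B\}\subseteq\mathcal W$ with $\underline{S_j}\cap B=\{j\}$; a reduced row-echelon form additionally has $S_j(k)=\delta_{jk}$ for $j,k\in B$. $\mathcal W$ is an $F$-vector set if $\mathcal W$ equals the set of all $X\in F^E$ such that for every support basis $B$ and every nearly reduced row-echelon form $\{S_j\}$ w.r.t. $B$, $X$ is a linear combination of $\{S_j:j\in B\}$. -}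

module Defs where

open import Level using (0ℓ)
open import Data.Nat using (ℕ)
open import Data.Fin using (Fin)
open import Data.Fin.Subset using (Subset; _∈_; _⊆_)
open import Data.Fin.Subset.Properties using (_∈?_)
open import Data.List using (List; []; _∷_; _++_; map; filter; catMaybes; allFin)
open import Data.List.Relation.Binary.Permutation.Propositional using (_↭_)
open import Data.Maybe using (Maybe; just; nothing)
open import Data.Product using (Σ; ∃; _×_; _,_)
open import Relation.Nullary using (¬_)
open import Relation.Binary.PropositionalEquality using (_≡_; _≢_)
open import Algebra.Structures using (IsAbelianGroup)

-- An element of the group semiring ℕ[G] is a
-- finite formal sum of elements of G, represented by a list of its terms
-- (with multiplicity); N is required to be invariant under reordering, so it
-- is really a subset of ℕ[G].  The empty list is the element 0 of ℕ[G].
record Tract : Set₁ where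
  field
    G        : Set
    _·_      : G → G → G
    one      : G
    _⁻¹      : G → G
    isAbelianGroup : IsAbelianGroup _≡_ _·_ one _⁻¹
    N        : List G → Set
    N-perm   : ∀ {xs ys} → xs ↭ ys → N xs → N ys
    N-zero   : N []
    N-one    : ¬ N (one ∷ [])
    η        : G
    η-spec   : N (one ∷ η ∷ [])
    η-unique : ∀ h → N (one ∷ h ∷ []) → h ≡ η
    N-mul    : ∀ g xs → N xs → N (map (g ·_) xs)

module _ (T : Tract) where
  open Tract T

  -- F = G ∪ {0}, with 0 = nothing
  F : Set
  F = Maybe G

  _⊙_ : F → F → F
  just a ⊙ just b = just (a · b)
  _      ⊙ _      = nothing

  -- -b as an element of ℕ[G] (zero term dropped)
  negTerm : F → List G
  negTerm nothing  = []
  negTerm (just b) = (η · b) ∷ []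

  -- b ∈ ⊞ as   iff   -b + Σ as ∈ N_G   (zero terms dropped)
  _∈⊞_ : F → List F → Set
  b ∈⊞ as = N (negTerm b ++ catMaybes as)

  module _ {n : ℕ} where
    Vect : Set
    Vect = Fin n → F

    isZero : Vect → Set
    isZero X = ∀ e → X e ≡ nothing

    Meets : (Vect → Set) → Subset n → Set
    Meets W B = ∀ X → W X → ¬ isZero X → ∃ λ e → e ∈ B × X e ≢ nothing

    SupportBasis : (Vect → Set) → Subset n → Set
    SupportBasis W B = Meets W B × (∀ B′ → B′ ⊆ B → Meets W B′ → B ⊆ B′)

    members : Subset n → List (Fin n)
    members B = filter (_∈? B) (allFin n)

    LinComb : Subset n → (Fin n → Vect) → Vect → Set
    LinComb B S X = Σ (Fin n → F) λ α →
      ∀ e → X e ∈⊞ map (λ j → α j ⊙ S j e) (members B)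

    NearlyRREF : (Vect → Set) → Subset n → (Fin n → Vect) → Set
    NearlyRREF W B S =
      (∀ j → j ∈ B → W (S j)) ×
      (∀ j k → j ∈ B → k ∈ B → (S j k ≢ nothing → j ≡ k) × (j ≡ k → S j k ≢ nothing))

    RREF : (Vect → Set) → Subset n → (Fin n → Vect) → Set
    RREF W B S = NearlyRREF W B S ×
      (∀ j k → j ∈ B → k ∈ B → (j ≡ k → S j k ≡ just one) × (j ≢ k → S j k ≡ nothing))

    FVectorSet : (Vect → Set) → Set
    FVectorSet W = ∀ X →
      (W X → ∀ B S → SupportBasis W B → NearlyRREF W B S → LinComb B S X) ×
      ((∀ B S → SupportBasis W B → NearlyRREF W B S → LinComb B S X) → W X)

-- S′ j lies in W, so it is a linear combination of the rows S i (i ∈ B).  On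
-- the coordinates in B the rows S i form an identity matrix, so reading off
-- those coordinates forces the coefficients to be δ i j.  Every coordinate of
-- S′ j then lies in a hypersum with the single term S j e, and in a tract a
-- one-term hypersum ⊞ a is {a}, because 1 + η ∈ N_G determines η uniquely
-- and no single group element lies in N_G.
module Submission where

open import Defs
open import Level using (0ℓ)
open import Data.Nat using (ℕ)
open import Data.Fin using (Fin)
open import Data.Fin.Properties using (_≟_)
open import Data.Fin.Subset using (Subset; _∈_)
open import Data.Fin.Subset.Properties using (_∈?_)
open import Data.List using ([]; _∷_; _++_; map; catMaybes; allFin)
open import Data.List.Properties using (catMaybes-++; ++-identityʳ)
open import Data.List.Membership.Propositional using () renaming (_∈_ to _∈ₗ_)
open import Data.List.Membership.Propositional.Properties using (∈-filter⁺; ∈-filter⁻; ∈-allFin)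
open import Data.List.Relation.Unary.Any using (here; there)
open import Data.List.Relation.Unary.All as All using (All; []; _∷_)
open import Data.List.Relation.Unary.AllPairs using (_∷_)
open import Data.List.Relation.Unary.Unique.Propositional using (Unique)
open import Data.List.Relation.Unary.Unique.Propositional.Properties using (filter⁺; allFin⁺)
open import Data.List.Relation.Binary.Permutation.Propositional using (swap; refl)
open import Data.Maybe using (Maybe; just; nothing)
open import Data.Product using (_×_; _,_; proj₁; proj₂)
open import Data.Empty using (⊥-elim)
open import Relation.Nullary using (¬_; yes; no)
open import Relation.Binary.PropositionalEquality
  using (_≡_; _≢_; refl; sym; trans; cong; subst; module ≡-Reasoning)
open import Algebra.Bundles using (Group)
open import Algebra.Structures using (IsAbelianGroup)
import Algebra.Properties.Group as GroupProperties

module _ {A B : Set} (f : A → Maybe B) where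

  catMaybes-map-nothing : ∀ {xs} → All (λ x → f x ≡ nothing) xs → catMaybes (map f xs) ≡ []
  catMaybes-map-nothing []                 = refl
  catMaybes-map-nothing (fx≡nothing ∷ fxs) rewrite fx≡nothing = catMaybes-map-nothing fxs

  catMaybes-map-single : ∀ {x xs} → Unique xs → x ∈ₗ xs →
    (∀ {y} → y ∈ₗ xs → y ≢ x → f y ≡ nothing) →
    catMaybes (map f xs) ≡ catMaybes (f x ∷ [])
  catMaybes-map-single {x} {x ∷ ys} (x∉ys ∷ _) (here refl) vanish = begin
    catMaybes (f x ∷ map f ys)                   ≡⟨ catMaybes-++ (f x ∷ []) (map f ys) ⟩
    catMaybes (f x ∷ []) ++ catMaybes (map f ys) ≡⟨ cong (catMaybes (f x ∷ []) ++_) (catMaybes-map-nothing fys) ⟩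
    catMaybes (f x ∷ []) ++ []                   ≡⟨ ++-identityʳ _ ⟩
    catMaybes (f x ∷ [])                         ∎
    where
    open ≡-Reasoning
    fys : All (λ y → f y ≡ nothing) ys
    fys = All.tabulate λ y∈ys → vanish (there y∈ys) λ y≡x → All.lookup x∉ys y∈ys (sym y≡x)
  catMaybes-map-single {x} {y ∷ ys} (y∉ys ∷ unique) (there x∈ys) vanish
    rewrite vanish (here refl) (All.lookup y∉ys x∈ys) =
    catMaybes-map-single unique x∈ys (λ z∈ys → vanish (there z∈ys))

module _ (T : Tract) where
  open Tract T
  open IsAbelianGroup isAbelianGroup using (isGroup; comm; identityˡ; identityʳ; inverseˡ)

  private
    group : Group 0ℓ 0ℓ
    group = record { _≈_ = _≡_; _∙_ = _·_; ε = one; _⁻¹ = _⁻¹; isGroup = isGroup }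

  open GroupProperties group using (∙-cancelˡ; \\-leftDividesˡ)

  ¬N-singleton : ∀ g → ¬ N (g ∷ [])
  ¬N-singleton g N[g] = N-one (subst (λ x → N (x ∷ [])) (inverseˡ g) (N-mul (g ⁻¹) _ N[g]))

  ∈⊞-singleton : ∀ {b a} → _∈⊞_ T b (a ∷ []) → b ≡ a
  ∈⊞-singleton {nothing} {nothing} _       = refl
  ∈⊞-singleton {nothing} {just a}  N[a]    = ⊥-elim (¬N-singleton a N[a])
  ∈⊞-singleton {just b}  {nothing} N[-b]   = ⊥-elim (¬N-singleton (η · b) N[-b])
  ∈⊞-singleton {just b}  {just a}  N[-b+a] = cong just (∙-cancelˡ η b a ηb≡ηa)
    where
    open ≡-Reasoning
    -- multiplying -b + a by a⁻¹ gives 1 + a⁻¹(-b), so a⁻¹(-b) = η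
    a⁻¹ηb≡η : (a ⁻¹) · (η · b) ≡ η
    a⁻¹ηb≡η = η-unique _ (subst (λ x → N (x ∷ (a ⁻¹) · (η · b) ∷ [])) (inverseˡ a)
                (N-mul (a ⁻¹) _ (N-perm (swap _ _ refl) N[-b+a])))
    ηb≡ηa : η · b ≡ η · a
    ηb≡ηa = begin
      η · b                  ≡⟨ sym (\\-leftDividesˡ a (η · b)) ⟩
      a · ((a ⁻¹) · (η · b)) ≡⟨ cong (a ·_) a⁻¹ηb≡η ⟩
      a · η                  ≡⟨ comm a η ⟩
      η · a                  ∎

  ∈⊞-single-term : ∀ {n} (f : Fin n → F T) {i xs b} → Unique xs → i ∈ₗ xs →
    (∀ {k} → k ∈ₗ xs → k ≢ i → f k ≡ nothing) →
    _∈⊞_ T b (map f xs) → b ≡ f i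
  ∈⊞-single-term f {b = b} unique i∈xs vanish b∈⊞ = ∈⊞-singleton
    (subst (λ terms → N (negTerm T b ++ terms)) (catMaybes-map-single f unique i∈xs vanish) b∈⊞)

  ⊙-zeroʳ : ∀ a → _⊙_ T a nothing ≡ nothing
  ⊙-zeroʳ nothing  = refl
  ⊙-zeroʳ (just _) = refl

  ⊙-identityˡ : ∀ a → _⊙_ T (just one) a ≡ a
  ⊙-identityˡ nothing  = refl
  ⊙-identityˡ (just a) = cong just (identityˡ a)

  ⊙-identityʳ : ∀ a → _⊙_ T a (just one) ≡ a
  ⊙-identityʳ nothing  = refl
  ⊙-identityʳ (just a) = cong just (identityʳ a)

  module _ {n : ℕ} {B : Subset n} where

    members-unique : Unique (members T B)
    members-unique = filter⁺ (_∈? B) (allFin⁺ n)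

    ∈-members⁺ : ∀ {k} → k ∈ B → k ∈ₗ members T B
    ∈-members⁺ {k} = ∈-filter⁺ (_∈? B) (∈-allFin k)

    ∈-members⁻ : ∀ {k} → k ∈ₗ members T B → k ∈ B
    ∈-members⁻ k∈ = proj₂ (∈-filter⁻ (_∈? B) {xs = allFin n} k∈)

    Reduced : (Fin n → Vect T {n}) → Set
    Reduced S = ∀ j k → j ∈ B → k ∈ B →
      (j ≡ k → S j k ≡ just one) × (j ≢ k → S j k ≡ nothing)

    Combination : (Fin n → Vect T {n}) → (Fin n → F T) → Vect T {n} → Set
    Combination S α X = ∀ e → _∈⊞_ T (X e) (map (λ i → _⊙_ T (α i) (S i e)) (members T B))

    reduced-rows-agree : ∀ {S S′ j k} → Reduced S → Reduced S′ → j ∈ B → k ∈ B → S j k ≡ S′ j k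
    reduced-rows-agree {j = j} {k} reduced reduced′ j∈B k∈B with j ≟ k
    ... | yes j≡k = trans (proj₁ (reduced j k j∈B k∈B) j≡k) (sym (proj₁ (reduced′ j k j∈B k∈B) j≡k))
    ... | no  j≢k = trans (proj₂ (reduced j k j∈B k∈B) j≢k) (sym (proj₂ (reduced′ j k j∈B k∈B) j≢k))

    combination-coefficient : ∀ {S α X k} → Reduced S → Combination S α X → k ∈ B → X k ≡ α k
    combination-coefficient {S} {α} {X} {k} reduced combination k∈B = begin
      X k                    ≡⟨ ∈⊞-single-term (λ i → _⊙_ T (α i) (S i k))
                                  members-unique (∈-members⁺ k∈B) vanish (combination k) ⟩
      _⊙_ T (α k) (S k k)    ≡⟨ cong (_⊙_ T (α k)) (proj₁ (reduced k k k∈B k∈B) refl) ⟩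
      _⊙_ T (α k) (just one) ≡⟨ ⊙-identityʳ (α k) ⟩
      α k                    ∎
      where
      open ≡-Reasoning
      vanish : ∀ {i} → i ∈ₗ members T B → i ≢ k → _⊙_ T (α i) (S i k) ≡ nothing
      vanish {i} i∈B i≢k =
        trans (cong (_⊙_ T (α i)) (proj₂ (reduced i k (∈-members⁻ i∈B) k∈B) i≢k)) (⊙-zeroʳ (α i))

    combination-of-reduced-row : ∀ {S X j} → Reduced S → j ∈ B → LinComb T B S X →
      (∀ k → k ∈ B → X k ≡ S j k) → ∀ e → X e ≡ S j e
    combination-of-reduced-row {S} {X} {j} reduced j∈B (α , combination) X≡Sj-on-B e = begin
      X e                      ≡⟨ ∈⊞-single-term (λ i → _⊙_ T (α i) (S i e))
                                    members-unique (∈-members⁺ j∈B) vanish (combination e) ⟩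
      _⊙_ T (α j) (S j e)      ≡⟨ cong (λ a → _⊙_ T a (S j e)) αj≡one ⟩
      _⊙_ T (just one) (S j e) ≡⟨ ⊙-identityˡ (S j e) ⟩
      S j e                    ∎
      where
      open ≡-Reasoning
      α≡Sj : ∀ {k} → k ∈ B → α k ≡ S j k
      α≡Sj k∈B = trans (sym (combination-coefficient reduced combination k∈B)) (X≡Sj-on-B _ k∈B)
      αj≡one : α j ≡ just one
      αj≡one = trans (α≡Sj j∈B) (proj₁ (reduced j j j∈B j∈B) refl)
      vanish : ∀ {i} → i ∈ₗ members T B → i ≢ j → _⊙_ T (α i) (S i e) ≡ nothing
      vanish {i} i∈B i≢j = cong (λ a → _⊙_ T a (S i e))
        (trans (α≡Sj (∈-members⁻ i∈B)) (proj₂ (reduced j i j∈B (∈-members⁻ i∈B)) λ j≡i → i≢j (sym j≡i)))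

proposition2p11 : (T : Tract) (n : ℕ) (W : Vect T {n} → Set) →
    FVectorSet T W → (B : Subset n) → SupportBasis T W B →
    (S S′ : Fin n → Vect T) → RREF T W B S → RREF T W B S′ →
    ∀ j → j ∈ B → ∀ e → S j e ≡ S′ j e
proposition2p11 T n W isVectorSet B basis S S′ (nearly , reduced) (nearly′ , reduced′) j j∈B e =
  sym (combination-of-reduced-row T reduced j∈B S′j-combination
        (λ k k∈B → sym (reduced-rows-agree T reduced reduced′ j∈B k∈B)) e)
  where
  S′j-combination : LinComb T B S (S′ j)
  S′j-combination = proj₁ (isVectorSet (S′ j)) (proj₁ nearly′ j j∈B) B S basis nearly
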